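{- Let $m$ and $k$ be positive integers such that $m\ge k+3$ and $2m-1<R(m-k,3)$. Suppose that $F_v(2_r;r-k+1)\ge r+m$ for every integer $r\ge m-1$. Then $F_v(2_r;r-k+1)=r+m$ for every integer $r\ge m-1$.
   Context: All graphs are finite, simple and undirected; $\omega(G)$ is the clique number and $\alpha(G)$ the independence number. $R(p,3)$ is the smallest $n$ such that every graph on at least $n$ vertices has $\omega(G)\ge p$ or $\alpha(G)\ge 3$. $G\overset{v}{\to}(2_r)$ means that for every partition of $V(G)$ into $r$ pairwise disjoint (possibly empty) sets, some part contains two adjacent vertices (equivalently $\chi(G)\ge r+1$). $F_v(2_r;q)$ is the minimum of $|V(G)|$ over graphs $G$ with $G\overset{v}{\to}(2_r)$ and $\omega(G)<q$ (exists iff $q\ge 3$). -}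

module Defs where

open import Data.Nat using (ℕ; _≤_; _<_; _+_; _∸_; _*_)
open import Data.Fin using (Fin)
open import Data.Bool using (Bool; true; false)
open import Data.Product using (Σ; ∃; ∃-syntax; _×_; _,_)
open import Data.Sum using (_⊎_)
open import Relation.Binary.PropositionalEquality using (_≡_; _≢_)
open import Relation.Nullary using (¬_)
open import Function.Definitions using (Injective)

record Graph (n : ℕ) : Set where
  field
    adj   : Fin n → Fin n → Bool
    sym   : ∀ u v → adj u v ≡ adj v u
    irrefl : ∀ u → adj u u ≡ false
open Graph public

HasClique : ∀ {n} → Graph n → ℕ → Set
HasClique {n} G p =
  Σ (Fin p → Fin n) λ f → Injective _≡_ _≡_ f × (∀ i j → i ≢ j → adj G (f i) (f j) ≡ true)

HasIndep : ∀ {n} → Graph n → ℕ → Set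
HasIndep {n} G p =
  Σ (Fin p → Fin n) λ f → Injective _≡_ _≡_ f × (∀ i j → i ≢ j → adj G (f i) (f j) ≡ false)

CliqueLT : ∀ {n} → Graph n → ℕ → Set
CliqueLT G q = ¬ HasClique G q

-- G →v (2_r): every partition of V(G) into r (possibly empty) parts,
-- given as a map c : V(G) → Fin r, has a part containing two adjacent vertices.
VArrow : ∀ {n} → Graph n → ℕ → Set
VArrow {n} G r = ∀ (c : Fin n → Fin r) → ∃[ u ] ∃[ v ] (adj G u v ≡ true × c u ≡ c v)

RamseyProp : ℕ → ℕ → Set
RamseyProp p N = ∀ n → N ≤ n → (G : Graph n) → HasClique G p ⊎ HasIndep G 3

IsRamsey3 : ℕ → ℕ → Set
IsRamsey3 p N = RamseyProp p N × (∀ M → RamseyProp p M → N ≤ M)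

-- "F_v(2_r; q) ≥ N": every graph G with G →v (2_r) and ω(G) < q has at least N vertices.
FvAtLeast : ℕ → ℕ → ℕ → Set
FvAtLeast r q N = ∀ n (G : Graph n) → VArrow G r → CliqueLT G q → N ≤ n

FvIs : ℕ → ℕ → ℕ → Set
FvIs r q N = (Σ (Graph N) λ G → VArrow G r × CliqueLT G q) × FvAtLeast r q N

-- By the hypothesis 2m − 1 < R(m − k, 3) there is a graph on 2m − 1 vertices with
-- ω < m − k and α < 3. In any colouring with m − 1 colours, pigeonhole yields three
-- vertices of one colour, and α < 3 makes two of them adjacent; so the graph arrows
-- (2_{m−1}). Adding a universal vertex raises both the number of colours and the clique
-- bound by one, and r − m + 1 such cones give a graph on r + m vertices showing
-- F_v(2_r; r − k + 1) ≤ r + m; the reverse inequality is assumed.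
-- Constructively, the Ramsey graph is obtained by exhaustive search: its existence is
-- decidable, so it suffices to refute its absence, which would make R(m − k, 3) ≤ 2m − 1.
module Submission where

open import Defs hiding (sym)
open import Data.Nat using (ℕ; zero; suc; _≤_; _<_; _+_; _∸_; _*_; z≤n; s≤s)
import Data.Nat.Properties as ℕ
open import Data.Nat.Induction using (<-rec)
open import Data.Fin using (Fin; zero; suc; punchIn; punchOut; inject≤)
open import Data.Fin.Properties
  using (_≟_; any?; all?; pigeonhole; punchIn-injective; punchInᵢ≢i; punchIn-punchOut;
         inject≤-injective; <⇒≢)
open import Data.Bool using (Bool; true; false)
import Data.Bool.Properties as Bool
open import Data.Vec.Functional using (_∷_; []; head; tail)
open import Data.Vec.Functional.Relation.Binary.Pointwise using (Pointwise)
open import Data.Product using (Σ; ∃; _×_; _,_)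
open import Data.Empty using (⊥-elim)
open import Data.Sum using (inj₁; inj₂)
open import Function using (_∘_)
open import Function.Definitions using (Injective)
open import Level using (0ℓ)
open import Relation.Binary.Core using (Rel)
open import Relation.Binary.Definitions using (Reflexive; _Respects_)
open import Relation.Binary.PropositionalEquality
  using (_≡_; _≢_; refl; sym; trans; cong; cong₂; subst; module ≡-Reasoning)
open import Relation.Nullary using (¬_; Dec; yes; no; contradiction)
open import Relation.Nullary.Decidable using (map′; _×-dec_; _→-dec_; ¬?; decidable-stable; ¬¬-excluded-middle)
open import Relation.Unary using (Pred; Decidable)

-- Function spaces are searched up to pointwise equality, for want of function extensionality.
Searchable : (A : Set) → Rel A 0ℓ → Set₁
Searchable A _≈_ = ∀ {P : Pred A 0ℓ} → P Respects _≈_ → Decidable P → Dec (∃ P)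

search-Bool : Searchable Bool _≡_
search-Bool {P} _ P? with P? true | P? false
... | yes p | _     = yes (true , p)
... | no _  | yes p = yes (false , p)
... | no ¬t | no ¬f = no λ { (true , p) → ¬t p ; (false , p) → ¬f p }

search-Fin : ∀ {n} → Searchable (Fin n) _≡_
search-Fin _ = any?

∷⁺ : ∀ {A : Set} (_≈_ : Rel A 0ℓ) {n a b} {g h : Fin n → A} →
  a ≈ b → Pointwise _≈_ g h → Pointwise _≈_ (a ∷ g) (b ∷ h)
∷⁺ _ a≈b _   zero    = a≈b
∷⁺ _ _   g≈h (suc i) = g≈h i

search-→ : ∀ {A _≈_} → Reflexive _≈_ → Searchable A _≈_ →
  ∀ n → Searchable (Fin n → A) (Pointwise _≈_)
search-→ _ _ zero resp P? = map′ ([] ,_) (λ (f , p) → resp (λ ()) p) (P? [])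
search-→ {A} {_≈_} ≈-refl search-A (suc n) resp P? =
  map′ (λ (a , g , p) → a ∷ g , p) (λ (f , p) → head f , tail f , resp head∷tail p)
    (search-A (λ a≈b (g , p) → g , resp (∷⁺ _≈_ a≈b λ _ → ≈-refl) p)
              λ a → search-→ ≈-refl search-A n (resp ∘ ∷⁺ _≈_ ≈-refl) (P? ∘ (a ∷_)))
  where
  head∷tail : ∀ {f : Fin (suc n) → A} → Pointwise _≈_ f (head f ∷ tail f)
  head∷tail zero    = ≈-refl
  head∷tail (suc _) = ≈-refl

Least : (ℕ → Set) → Set
Least P = ∃ λ m → P m × (∀ k → P k → m ≤ k)

¬¬-least : (P : ℕ → Set) → ∀ n → P n → ¬ ¬ Least P
¬¬-least P = <-rec _ λ n rec pn ¬least → ¬¬-excluded-middle {A = ∃ λ m → m < n × P m} λ where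
  (yes (m , m<n , pm)) → rec m<n pm ¬least
  (no ¬smaller)        → ¬least (n , pn , λ k pk → ℕ.≮⇒≥ λ k<n → ¬smaller (k , k<n , pk))

Homogeneous : ∀ {n} → (Fin n → Fin n → Bool) → Bool → ℕ → Set
Homogeneous {n} a b p =
  Σ (Fin p → Fin n) λ f → Injective _≡_ _≡_ f × (∀ i j → i ≢ j → a (f i) (f j) ≡ b)

Homogeneous-resp : ∀ {n} {a a′ : Fin n → Fin n → Bool} {b p} →
  Pointwise (Pointwise _≡_) a a′ → Homogeneous a b p → Homogeneous a′ b p
Homogeneous-resp a≈a′ (f , f-inj , hom) =
  f , f-inj , λ i j i≢j → trans (sym (a≈a′ (f i) (f j))) (hom i j i≢j)

injective? : ∀ {p n} (f : Fin p → Fin n) → Dec (Injective _≡_ _≡_ f)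
injective? f = map′ (λ inj → inj _ _) (λ inj _ _ → inj)
  (all? λ x → all? λ y → (f x ≟ f y) →-dec (x ≟ y))

homogeneous? : ∀ {n} (a : Fin n → Fin n → Bool) b p → Dec (Homogeneous a b p)
homogeneous? a b p = search-→ refl search-Fin p
  (λ f≗g (f-inj , hom) → (λ gx≡gy → f-inj (trans (f≗g _) (trans gx≡gy (sym (f≗g _))))) ,
                         (λ i j i≢j → trans (sym (cong₂ a (f≗g i) (f≗g j))) (hom i j i≢j)))
  (λ f → injective? f ×-dec all? λ i → all? λ j → ¬? (i ≟ j) →-dec (a (f i) (f j) Bool.≟ b))

RamseyWitness : ℕ → ℕ → Set
RamseyWitness n p = Σ (Graph n) λ G → CliqueLT G p × ¬ HasIndep G 3

IsRamseyWitness : ∀ {n} → ℕ → (Fin n → Fin n → Bool) → Set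
IsRamseyWitness p a =
  (∀ u v → a u v ≡ a v u) × (∀ u → a u u ≡ false) × ¬ Homogeneous a true p × ¬ Homogeneous a false 3

IsRamseyWitness-resp : ∀ {n} p → IsRamseyWitness {n} p Respects Pointwise (Pointwise _≡_)
IsRamseyWitness-resp p {a} {a′} a≈a′ (symmetric , irreflexive , ¬clique , ¬indep) =
  (λ u v → trans (sym (a≈a′ u v)) (trans (symmetric u v) (a≈a′ v u))) ,
  (λ u → trans (sym (a≈a′ u u)) (irreflexive u)) ,
  ¬clique ∘ Homogeneous-resp a′≈a ,
  ¬indep ∘ Homogeneous-resp a′≈a
  where
  a′≈a : Pointwise (Pointwise _≡_) a′ a
  a′≈a u v = sym (a≈a′ u v)

isRamseyWitness? : ∀ {n} p (a : Fin n → Fin n → Bool) → Dec (IsRamseyWitness p a)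
isRamseyWitness? p a =
  (all? λ u → all? λ v → a u v Bool.≟ a v u) ×-dec (all? λ u → a u u Bool.≟ false) ×-dec
  ¬? (homogeneous? a true p) ×-dec ¬? (homogeneous? a false 3)

ramseyWitness? : ∀ n p → Dec (RamseyWitness n p)
ramseyWitness? n p =
  map′ (λ (a , symmetric , irreflexive , ¬clique , ¬indep) →
          record { adj = a ; sym = symmetric ; irrefl = irreflexive } , ¬clique , ¬indep)
       (λ (G , ¬clique , ¬indep) → adj G , Graph.sym G , irrefl G , ¬clique , ¬indep)
       (search-→ (λ _ → refl) (search-→ refl search-Bool n) n
                 (IsRamseyWitness-resp p) (isRamseyWitness? p))

restrict : ∀ {N n} → N ≤ n → Graph n → Graph N
restrict N≤n G = record
  { adj    = λ u v → adj G (inject≤ u N≤n) (inject≤ v N≤n)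
  ; sym    = λ u v → Graph.sym G _ _
  ; irrefl = λ u → irrefl G _
  }

Homogeneous-restrict : ∀ {N n} (N≤n : N ≤ n) (G : Graph n) {b p} →
  Homogeneous (adj (restrict N≤n G)) b p → Homogeneous (adj G) b p
Homogeneous-restrict N≤n G (f , f-inj , hom) =
  (λ i → inject≤ (f i) N≤n) , f-inj ∘ inject≤-injective N≤n N≤n _ _ , hom

¬RamseyWitness⇒RamseyProp : ∀ N p → ¬ RamseyWitness N p → RamseyProp p N
¬RamseyWitness⇒RamseyProp N p ¬w n N≤n G
  with homogeneous? (adj (restrict N≤n G)) true p | homogeneous? (adj (restrict N≤n G)) false 3
... | yes clique | _          = inj₁ (Homogeneous-restrict N≤n G clique)
... | no _       | yes indep  = inj₂ (Homogeneous-restrict N≤n G indep)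
... | no ¬clique | no ¬indep  = contradiction (restrict N≤n G , ¬clique , ¬indep) ¬w

ramseyWitness-below : ∀ N p → (∀ R → IsRamsey3 p R → N < R) → RamseyWitness N p
ramseyWitness-below N p N<R = decidable-stable (ramseyWitness? N p) λ ¬w →
  let ramsey = ¬RamseyWitness⇒RamseyProp N p ¬w in
  ¬¬-least (RamseyProp p) N ramsey λ (R , isR , least) →
    ℕ.<⇒≱ (N<R R (isR , least)) (least N ramsey)

∷-injective : ∀ {n m} {a : Fin m} {g : Fin n → Fin m} →
  Injective _≡_ _≡_ g → (∀ i → g i ≢ a) → Injective _≡_ _≡_ (a ∷ g)
∷-injective _     _   {zero}  {zero}  _     = refl
∷-injective _     g≢a {zero}  {suc j} a≡gj  = contradiction (sym a≡gj) (g≢a j)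
∷-injective _     g≢a {suc i} {zero}  gi≡a  = contradiction gi≡a (g≢a i)
∷-injective g-inj _   {suc i} {suc j} gi≡gj = cong suc (g-inj gi≡gj)

avoid-two : ∀ {n} {i j : Fin (suc (suc n))} → i ≢ j →
  ∃ λ (e : Fin n → Fin (suc (suc n))) → Injective _≡_ _≡_ e × (∀ x → e x ≢ i) × (∀ x → e x ≢ j)
avoid-two {n} {i} {j} i≢j = e , e-inj , (λ x → punchInᵢ≢i i _) , e≢j
  where
  j′ : Fin (suc n)
  j′ = punchOut i≢j
  e : Fin n → Fin (suc (suc n))
  e x = punchIn i (punchIn j′ x)
  e-inj : Injective _≡_ _≡_ e
  e-inj ex≡ey = punchIn-injective j′ _ _ (punchIn-injective i _ _ ex≡ey)
  e≢j : ∀ x → e x ≢ j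
  e≢j x ex≡j = punchInᵢ≢i j′ x (punchIn-injective i _ _ (trans ex≡j (sym (punchIn-punchOut i≢j))))

remove-colour : ∀ {n t} (c : Fin n → Fin (suc t)) {col} → (∀ x → c x ≢ col) →
  ∃ λ (c′ : Fin n → Fin t) → ∀ x → c x ≡ punchIn col (c′ x)
remove-colour c c≢col = (λ x → punchOut (c≢col x ∘ sym)) , λ x → sym (punchIn-punchOut _)

MonochromaticTriple : ∀ {n t} → (Fin n → Fin t) → Set
MonochromaticTriple {n} c =
  Σ (Fin 3 → Fin n) λ f → Injective _≡_ _≡_ f × ∃ λ col → ∀ a → c (f a) ≡ col

MonochromaticTriple-lift : ∀ {n t} (c : Fin (suc (suc n)) → Fin (suc t)) {i j} → i ≢ j →
  (∀ k → k ≢ i → k ≢ j → c k ≢ c i) → (∀ (c′ : Fin n → Fin t) → MonochromaticTriple c′) →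
  MonochromaticTriple c
MonochromaticTriple-lift c {i} i≢j unique triple =
  let e , e-inj , e≢i , e≢j = avoid-two i≢j
      c′ , c≡c′             = remove-colour (c ∘ e) λ x → unique (e x) (e≢i x) (e≢j x)
      f , f-inj , col , mono = triple c′
  in e ∘ f , f-inj ∘ e-inj , punchIn (c i) col , λ a → trans (c≡c′ (f a)) (cong (punchIn (c i)) (mono a))

pigeonhole₃ : ∀ t n → 2 * t < n → (c : Fin n → Fin t) → MonochromaticTriple c
pigeonhole₃ zero    (suc n)       _         c = contradiction (c zero) λ ()
pigeonhole₃ (suc t) (suc zero)    (s≤s ())  c
pigeonhole₃ (suc t) (suc (suc n)) lt c with pigeonhole (ℕ.≤-<-trans (ℕ.m≤n*m (suc t) 2) lt) c
... | i , j , i<j , ci≡cj with any? (λ k → ¬? (k ≟ i) ×-dec ¬? (k ≟ j) ×-dec (c k ≟ c i))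
...   | yes (k , k≢i , k≢j , ck≡ci) = (k ∷ i ∷ j ∷ []) , kij-inj , c i , λ where
          zero             → ck≡ci
          (suc zero)       → refl
          (suc (suc zero)) → sym ci≡cj
  where
  kij-inj : Injective _≡_ _≡_ (k ∷ i ∷ j ∷ [])
  kij-inj = ∷-injective (∷-injective (∷-injective (λ { {()} }) λ ())
                                     λ { zero → <⇒≢ i<j ∘ sym ; (suc ()) })
                        λ { zero → k≢i ∘ sym ; (suc zero) → k≢j ∘ sym ; (suc (suc ())) }
...   | no ¬third =
  MonochromaticTriple-lift c (<⇒≢ i<j) (λ k k≢i k≢j ck≡ci → ¬third (k , k≢i , k≢j , ck≡ci))
    (pigeonhole₃ t n (ℕ.+-cancelˡ-< 2 (2 * t) n (subst (_< 2 + n) (ℕ.*-suc 2 t) lt)))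

α<3⇒arrow : ∀ {n} t → 2 * t < n → (G : Graph n) → ¬ HasIndep G 3 → VArrow G t
α<3⇒arrow t 2t<n G ¬indep c with pigeonhole₃ t _ 2t<n c
... | f , f-inj , col , mono with any? (λ a → any? λ b → ¬? (a ≟ b) ×-dec (adj G (f a) (f b) Bool.≟ true))
...   | yes (a , b , _ , edge) = f a , f b , edge , trans (mono a) (sym (mono b))
...   | no ¬edge =
  ⊥-elim (¬indep (f , f-inj , λ a b a≢b → Bool.¬-not λ edge → ¬edge (a , b , a≢b , edge)))

ArrowGraph : ℕ → ℕ → ℕ → Set
ArrowGraph r q n = Σ (Graph n) λ G → VArrow G r × CliqueLT G q

cone : ∀ {n} → Graph n → Graph (suc n)
cone {n} G = record { adj = adj′ ; sym = sym′ ; irrefl = irrefl′ }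
  where
  adj′ : Fin (suc n) → Fin (suc n) → Bool
  adj′ zero    zero    = false
  adj′ zero    (suc _) = true
  adj′ (suc _) zero    = true
  adj′ (suc u) (suc v) = adj G u v
  sym′ : ∀ u v → adj′ u v ≡ adj′ v u
  sym′ zero    zero    = refl
  sym′ zero    (suc v) = refl
  sym′ (suc u) zero    = refl
  sym′ (suc u) (suc v) = Graph.sym G u v
  irrefl′ : ∀ u → adj′ u u ≡ false
  irrefl′ zero    = refl
  irrefl′ (suc u) = irrefl G u

cone-arrow : ∀ {n r} (G : Graph n) → VArrow G r → VArrow (cone G) (suc r)
cone-arrow G arrow c with any? (λ v → c (suc v) ≟ c zero)
... | yes (v , same) = zero , suc v , refl , sym same
... | no ¬same =
  let c′ , c≡c′ = remove-colour (c ∘ suc) λ v same → ¬same (v , same)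
      u , v , edge , c′u≡c′v = arrow c′
  in suc u , suc v , edge , trans (c≡c′ u) (trans (cong (punchIn (c zero)) c′u≡c′v) (sym (c≡c′ v)))

injective-avoid : ∀ {q m} {f : Fin (suc q) → Fin m} → Injective _≡_ _≡_ f →
  ∀ y → ∃ λ i → ∀ j → f (punchIn i j) ≢ y
injective-avoid {f = f} f-inj y with any? (λ i → f i ≟ y)
... | yes (i , fi≡y) = i , λ j fj≡y → punchInᵢ≢i i j (f-inj (trans fj≡y (sym fi≡y)))
... | no ¬hit = zero , λ j fj≡y → ¬hit (_ , fj≡y)

cone-clique : ∀ {n q} (G : Graph n) → CliqueLT G q → CliqueLT (cone G) (suc q)
cone-clique {q = q} G ¬clique (f , f-inj , clique) with injective-avoid f-inj zero
... | i₀ , avoids-apex = ¬clique (g , g-inj , λ i j i≢j →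
  trans (cong₂ (adj (cone G)) (suc-g i) (suc-g j)) (clique _ _ (i≢j ∘ punchIn-injective i₀ i j)))
  where
  g : Fin q → _
  g j = punchOut (avoids-apex j ∘ sym)
  suc-g : ∀ j → suc (g j) ≡ f (punchIn i₀ j)
  suc-g j = punchIn-punchOut {i = zero} _
  g-inj : Injective _≡_ _≡_ g
  g-inj {x} {y} gx≡gy =
    punchIn-injective i₀ x y (f-inj (trans (sym (suc-g x)) (trans (cong suc gx≡gy) (suc-g y))))

iterated-cone : ∀ d {n r q} → ArrowGraph r q n → ArrowGraph (d + r) (d + q) (d + n)
iterated-cone zero    H = H
iterated-cone (suc d) H =
  let G , arrow , ¬clique = iterated-cone d H
  in cone G , cone-arrow G arrow , cone-clique G ¬clique

ArrowGraph-cong : ∀ {r r′ q q′ n n′} → r ≡ r′ → q ≡ q′ → n ≡ n′ →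
  ArrowGraph r q n → ArrowGraph r′ q′ n′
ArrowGraph-cong refl refl refl H = H

Fv-upperBound : ∀ m k → k < m → (∀ R → IsRamsey3 (m ∸ k) R → 2 * m ∸ 1 < R) →
  ∀ r → m ∸ 1 ≤ r → ArrowGraph r (r ∸ k + 1) (r + m)
Fv-upperBound (suc m) k (s≤s k≤m) 2m+1<R r m≤r with ℕ.m≤n⇒∃[o]m+o≡n m≤r
... | d , refl = ArrowGraph-cong (ℕ.+-comm d m) clique-bound vertices (iterated-cone d base)
  where
  open ≡-Reasoning
  2m+1≡m+[1+m] : 2 * suc m ∸ 1 ≡ m + suc m
  2m+1≡m+[1+m] = cong (m +_) (ℕ.+-identityʳ (suc m))
  2m<2m+1 : 2 * m < 2 * suc m ∸ 1
  2m<2m+1 = ℕ.≤-reflexive (sym (ℕ.+-suc m (m + 0)))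
  base : ArrowGraph m (suc m ∸ k) (2 * suc m ∸ 1)
  base =
    let G , ¬clique , ¬indep = ramseyWitness-below (2 * suc m ∸ 1) (suc m ∸ k) 2m+1<R
    in G , α<3⇒arrow m 2m<2m+1 G ¬indep , ¬clique
  clique-bound : d + (suc m ∸ k) ≡ m + d ∸ k + 1
  clique-bound = begin
    d + (suc m ∸ k)   ≡⟨ ℕ.+-comm d _ ⟩
    (suc m ∸ k) + d   ≡⟨ ℕ.+-∸-comm d (ℕ.m≤n⇒m≤1+n k≤m) ⟨
    suc m + d ∸ k     ≡⟨ cong (_∸ k) (ℕ.+-comm 1 (m + d)) ⟩
    m + d + 1 ∸ k     ≡⟨ ℕ.+-∸-comm 1 (ℕ.m≤n⇒m≤n+o d k≤m) ⟩
    m + d ∸ k + 1     ∎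
  vertices : d + (2 * suc m ∸ 1) ≡ m + d + suc m
  vertices = begin
    d + (2 * suc m ∸ 1) ≡⟨ cong (d +_) 2m+1≡m+[1+m] ⟩
    d + (m + suc m)     ≡⟨ ℕ.+-assoc d m (suc m) ⟨
    d + m + suc m       ≡⟨ cong (_+ suc m) (ℕ.+-comm d m) ⟩
    m + d + suc m       ∎

lemma2p3 : ∀ (m k : ℕ) → 1 ≤ k → k + 3 ≤ m
    → (∀ R → IsRamsey3 (m ∸ k) R → 2 * m ∸ 1 < R)
    → (∀ r → m ∸ 1 ≤ r → FvAtLeast r (r ∸ k + 1) (r + m))
    → (∀ r → m ∸ 1 ≤ r → FvIs r (r ∸ k + 1) (r + m))
lemma2p3 m k _ k+3≤m 2m-1<R lower r m-1≤r =
  Fv-upperBound m k (ℕ.<-≤-trans (ℕ.m<m+n k (s≤s z≤n)) k+3≤m) 2m-1<R r m-1≤r , lower r m-1≤r
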